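{- For all nonnegative integers $d,m$ and every positive integer $t$, $b(d,m;t)\ge\binom{d+m+t}{t}$.
   Context: A family of sets is a set $F$ of sets. Put $F^0=F$ and $F^{k+1}=\{A\cap B:\ A,B\in F^k,\ A\neq B\}$; $F$ has the $[d,m]$-property if $|A|\le d$ for all $A\in F^m$. A set $X$ with $|X|\le t$ is a $t$-transversal of $F$ if it meets every member of $F$. $F$ has the $t$-property if for every $A\in F$ the family $F\setminus\{A\}$ has a $t$-transversal $X$ with $X\cap A=\emptyset$. $b(d,m;t)$ is the supremum of $|F|$ over all families $F$ with the $[d,m]$-property and the $t$-property. -}

module Defs where

open import Data.Nat using (ℕ; zero; suc; _≤_)
open import Data.Fin.Subset using (Subset; _∩_; ∣_∣; Nonempty; ⊥)
open import Data.List using (List; length)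
open import Data.List.Membership.Propositional using (_∈_)
open import Data.Product using (Σ; _×_)
open import Relation.Binary.PropositionalEquality using (_≡_; _≢_)

-- A family of sets over the ground set Fin n is a list of subsets;
-- it is a genuine family (set of sets) when the list has no duplicates.

data Iter {n : ℕ} (F : List (Subset n)) : ℕ → Subset n → Set where
  base : ∀ {S} → S ∈ F → Iter F zero S
  step : ∀ {k A B} → Iter F k A → Iter F k B → A ≢ B → Iter F (suc k) (A ∩ B)

DMProperty : {n : ℕ} → ℕ → ℕ → List (Subset n) → Set
DMProperty d m F = ∀ S → Iter F m S → ∣ S ∣ ≤ d

TransversalAvoiding : {n : ℕ} → ℕ → List (Subset n) → Subset n → Subset n → Set
TransversalAvoiding t F A X =
  (∣ X ∣ ≤ t) × (X ∩ A ≡ ⊥) × (∀ B → B ∈ F → B ≢ A → Nonempty (X ∩ B))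

TProperty : {n : ℕ} → ℕ → List (Subset n) → Set
TProperty {n} t F = ∀ A → A ∈ F → Σ (Subset n) (TransversalAvoiding t F A)

module Submission where

-- The lower bound b(d,m;t) ≥ C(d+m+t, t) is witnessed by the family of
-- complements of all t-element subsets of an N-element set, N = d+m+t.
--
--  * t-property: for A = ∁ Y the set Y itself is a t-transversal avoiding A;
--    it meets every other member ∁ Z because |Z| = |Y| and Z ≠ Y force
--    Y ∖ Z ≠ ∅.
--  * [d,m]-property: intersecting two distinct sets yields a set strictly
--    smaller than one of them, so every member of F^k has size at most
--    (maximal size in F) − k.  Members of F have size N − t = d + m, hence
--    members of F^m have size at most d.
--  * The family has exactly C(N,t) members, all distinct.
-- The construction works for every t.

open import Defs
open import Data.Nat using (ℕ; zero; suc; _≤_; _<_; _+_; _∸_; s≤s)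
open import Data.Nat.Properties
open import Data.Nat.Combinatorics using (_C_; nCk+nC[k+1]≡[n+1]C[k+1])
open import Data.Bool using (not)
open import Data.Bool.Properties using (not-involutive)
open import Data.Fin as Fin using ()
open import Data.Fin.Subset using (Subset; inside; outside; ∁; _∩_; ∣_∣; Nonempty)
open import Data.Fin.Subset.Properties using (∣∁p∣≡n∸∣p∣; ∣p∩q∣≤∣p∣; ∣p∩q∣≤∣q∣; ∩-inverseʳ)
open import Data.Vec using ([]; _∷_; here; there)
import Data.Vec as Vec
open import Data.Vec.Properties using (∷-injectiveʳ; map-∘; map-cong; map-id)
open import Data.List using (List; []; _∷_; length; map; _++_)
open import Data.List.Properties using (length-map; length-++)
open import Data.List.Membership.Propositional using (_∈_)
open import Data.List.Membership.Propositional.Properties using (∈-map⁻; ∈-++⁻)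
open import Data.List.Relation.Unary.Any using (here)
open import Data.List.Relation.Unary.AllPairs using ([]; _∷_)
open import Data.List.Relation.Unary.All using ([])
open import Data.List.Relation.Unary.Unique.Propositional using (Unique)
open import Data.List.Relation.Unary.Unique.Propositional.Properties using (map⁺; ++⁺)
open import Data.List.Relation.Binary.Disjoint.Propositional using (Disjoint)
open import Data.Product using (Σ; _×_; _,_)
open import Data.Sum as Sum using (_⊎_; inj₁; inj₂)
open import Data.Empty using (⊥-elim)
open import Relation.Binary.PropositionalEquality
open import Function using (_∘_)

subsetsOfSize : (n k : ℕ) → List (Subset n)
subsetsOfSize zero    zero    = [] ∷ []
subsetsOfSize zero    (suc k) = []
subsetsOfSize (suc n) zero    = map (outside ∷_) (subsetsOfSize n zero)
subsetsOfSize (suc n) (suc k) =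
  map (inside ∷_) (subsetsOfSize n k) ++ map (outside ∷_) (subsetsOfSize n (suc k))

length-subsetsOfSize : ∀ n k → length (subsetsOfSize n k) ≡ n C k
length-subsetsOfSize zero    zero    = refl
length-subsetsOfSize zero    (suc k) = refl
length-subsetsOfSize (suc n) zero    =
  trans (length-map _ (subsetsOfSize n zero)) (length-subsetsOfSize n zero)
length-subsetsOfSize (suc n) (suc k) = begin
  length (with-first ++ without-first)
    ≡⟨ length-++ with-first ⟩
  length with-first + length without-first
    ≡⟨ cong₂ _+_ (trans (length-map _ (subsetsOfSize n k)) (length-subsetsOfSize n k))
                 (trans (length-map _ (subsetsOfSize n (suc k))) (length-subsetsOfSize n (suc k))) ⟩
  n C k + n C suc k
    ≡⟨ nCk+nC[k+1]≡[n+1]C[k+1] n k ⟩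
  suc n C suc k ∎
  where
  open ≡-Reasoning
  with-first    = map (inside ∷_) (subsetsOfSize n k)
  without-first = map (outside ∷_) (subsetsOfSize n (suc k))

∈-subsetsOfSize⇒∣∣≡ : ∀ n k {Y} → Y ∈ subsetsOfSize n k → ∣ Y ∣ ≡ k
∈-subsetsOfSize⇒∣∣≡ zero    zero    (here refl) = refl
∈-subsetsOfSize⇒∣∣≡ (suc n) zero    Y∈ with ∈-map⁻ _ Y∈
... | _ , Z∈ , refl = ∈-subsetsOfSize⇒∣∣≡ n zero Z∈
∈-subsetsOfSize⇒∣∣≡ (suc n) (suc k) Y∈ with ∈-++⁻ (map (inside ∷_) (subsetsOfSize n k)) Y∈
... | inj₁ Y∈with with ∈-map⁻ _ Y∈with
...   | _ , Z∈ , refl = cong suc (∈-subsetsOfSize⇒∣∣≡ n k Z∈)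
∈-subsetsOfSize⇒∣∣≡ (suc n) (suc k) Y∈ | inj₂ Y∈without with ∈-map⁻ _ Y∈without
...   | _ , Z∈ , refl = ∈-subsetsOfSize⇒∣∣≡ n (suc k) Z∈

subsetsOfSize-unique : ∀ n k → Unique (subsetsOfSize n k)
subsetsOfSize-unique zero    zero    = [] ∷ []
subsetsOfSize-unique zero    (suc k) = []
subsetsOfSize-unique (suc n) zero    = map⁺ ∷-injectiveʳ (subsetsOfSize-unique n zero)
subsetsOfSize-unique (suc n) (suc k) =
  ++⁺ (map⁺ ∷-injectiveʳ (subsetsOfSize-unique n k))
      (map⁺ ∷-injectiveʳ (subsetsOfSize-unique n (suc k)))
      first-point-separates
  where
  first-point-separates : Disjoint (map (inside ∷_) (subsetsOfSize n k))
                                   (map (outside ∷_) (subsetsOfSize n (suc k)))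
  first-point-separates (Y∈with , Y∈without) with ∈-map⁻ _ Y∈with | ∈-map⁻ _ Y∈without
  ... | _ , _ , refl | _ , _ , ()

∁-involutive : ∀ {n} (p : Subset n) → ∁ (∁ p) ≡ p
∁-involutive p = begin
  Vec.map not (Vec.map not p) ≡⟨ map-∘ not not p ⟨
  Vec.map (λ b → not (not b)) p ≡⟨ map-cong not-involutive p ⟩
  Vec.map (λ b → b) p ≡⟨ map-id p ⟩
  p ∎
  where
  open ≡-Reasoning

∁-injective : ∀ {n} {p q : Subset n} → ∁ p ≡ ∁ q → p ≡ q
∁-injective {p = p} {q} ∁p≡∁q =
  trans (sym (∁-involutive p)) (trans (cong ∁ ∁p≡∁q) (∁-involutive q))

∩-strictly-shrinks : ∀ {n} (p q : Subset n) → p ≢ q → ∣ p ∩ q ∣ < ∣ p ∣ ⊎ ∣ p ∩ q ∣ < ∣ q ∣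
∩-strictly-shrinks []            []            p≢q = ⊥-elim (p≢q refl)
∩-strictly-shrinks (inside ∷ p)  (inside ∷ q)  p≢q =
  Sum.map s≤s s≤s (∩-strictly-shrinks p q (p≢q ∘ cong (inside ∷_)))
∩-strictly-shrinks (outside ∷ p) (outside ∷ q) p≢q =
  ∩-strictly-shrinks p q (p≢q ∘ cong (outside ∷_))
∩-strictly-shrinks (inside ∷ p)  (outside ∷ q) _ = inj₁ (s≤s (∣p∩q∣≤∣p∣ p q))
∩-strictly-shrinks (outside ∷ p) (inside ∷ q)  _ = inj₂ (s≤s (∣p∩q∣≤∣q∣ p q))

nonempty-∷ : ∀ {n} {x} {p : Subset n} → Nonempty p → Nonempty (x ∷ p)
nonempty-∷ (i , i∈p) = Fin.suc i , there i∈p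

difference-nonempty : ∀ {n} (p q : Subset n) → ∣ q ∣ ≤ ∣ p ∣ → p ≢ q → Nonempty (p ∩ ∁ q)
difference-nonempty []            []            _         p≢q = ⊥-elim (p≢q refl)
difference-nonempty (inside ∷ p)  (outside ∷ q) _         _   = Fin.zero , here
difference-nonempty (inside ∷ p)  (inside ∷ q)  (s≤s q≤p) p≢q =
  nonempty-∷ (difference-nonempty p q q≤p (p≢q ∘ cong (inside ∷_)))
difference-nonempty (outside ∷ p) (outside ∷ q) q≤p       p≢q =
  nonempty-∷ (difference-nonempty p q q≤p (p≢q ∘ cong (outside ∷_)))
difference-nonempty (outside ∷ p) (inside ∷ q)  q<p       _   =
  nonempty-∷ (difference-nonempty p q (<⇒≤ q<p) (λ p≡q → <⇒≢ q<p (cong ∣_∣ (sym p≡q))))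

-- Bookkeeping for one intersection step: shrinking by one pays for one level.
one-more-step : ∀ {x y k s} → x < y → y + k ≤ s → x + suc k ≤ s
one-more-step {x} {y} {k} {s} x<y y+k≤s = begin
  x + suc k ≡⟨ +-suc x k ⟩
  suc x + k ≤⟨ +-monoˡ-≤ k x<y ⟩
  y + k     ≤⟨ y+k≤s ⟩
  s         ∎
  where open ≤-Reasoning

-- Each proper intersection step strictly decreases size, so if all members
-- of F have at most s elements, every member of F^k has at most s − k.
Iter-shrinks : ∀ {n} {F : List (Subset n)} {s} →
  (∀ {A} → A ∈ F → ∣ A ∣ ≤ s) → ∀ {k S} → Iter F k S → ∣ S ∣ + k ≤ s
Iter-shrinks small (base S∈F) = ≤-trans (≤-reflexive (+-identityʳ _)) (small S∈F)
Iter-shrinks small (step {A = A} {B} A∈ B∈ A≢B) with ∩-strictly-shrinks A B A≢B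
... | inj₁ smaller-than-A = one-more-step smaller-than-A (Iter-shrinks small A∈)
... | inj₂ smaller-than-B = one-more-step smaller-than-B (Iter-shrinks small B∈)

small-family⇒DMProperty : ∀ {n} {F : List (Subset n)} d m →
  (∀ {A} → A ∈ F → ∣ A ∣ ≤ d + m) → DMProperty d m F
small-family⇒DMProperty d m small S S∈F^m = +-cancelʳ-≤ m ∣ S ∣ d (Iter-shrinks small S∈F^m)

-- The complements of a family of t-element sets have the t-property: for
-- A = ∁ Y the set Y is disjoint from A and meets every other ∁ Z, since
-- Z ≠ Y have the same size and so Y ⊈ Z.
complements-TProperty : ∀ {n} {G : List (Subset n)} t →
  (∀ {Y} → Y ∈ G → ∣ Y ∣ ≡ t) → TProperty t (map ∁ G)
complements-TProperty {G = G} t uniform A A∈ with ∈-map⁻ ∁ A∈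
... | Y , Y∈G , refl = Y , ≤-reflexive (uniform Y∈G) , ∩-inverseʳ Y , meets-others
  where
  meets-others : ∀ B → B ∈ map ∁ G → B ≢ ∁ Y → Nonempty (Y ∩ B)
  meets-others B B∈ B≢∁Y with ∈-map⁻ ∁ B∈
  ... | Z , Z∈G , refl =
    difference-nonempty Y Z (≤-reflexive (trans (uniform Z∈G) (sym (uniform Y∈G))))
                        (B≢∁Y ∘ cong ∁ ∘ sym)

proposition2 : (d m t : ℕ) → 1 ≤ t →
    Σ ℕ (λ n → Σ (List (Subset n)) (λ F →
    Unique F × DMProperty d m F × TProperty t F × ((d + m + t) C t) ≤ length F))
proposition2 d m t _ =
  N , F , map⁺ ∁-injective (subsetsOfSize-unique N t)
    , small-family⇒DMProperty d m complement-size
    , complements-TProperty t (∈-subsetsOfSize⇒∣∣≡ N t)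
    , ≤-reflexive (sym (trans (length-map ∁ (subsetsOfSize N t)) (length-subsetsOfSize N t)))
  where
  N : ℕ
  N = d + m + t

  F : List (Subset N)
  F = map ∁ (subsetsOfSize N t)

  complement-size : ∀ {A} → A ∈ F → ∣ A ∣ ≤ d + m
  complement-size A∈F with ∈-map⁻ ∁ A∈F
  ... | Y , Y∈ , refl = ≤-reflexive (begin
    ∣ ∁ Y ∣   ≡⟨ ∣∁p∣≡n∸∣p∣ Y ⟩
    N ∸ ∣ Y ∣ ≡⟨ cong (N ∸_) (∈-subsetsOfSize⇒∣∣≡ N t Y∈) ⟩
    N ∸ t     ≡⟨ m+n∸n≡m (d + m) t ⟩
    d + m     ∎)
    where open ≡-Reasoning
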